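{- There is an online algorithm which, for any given flow scheduling instance $I$, computes a schedule of the instance obtained from $I$ by increasing the capacity of each port $p$ to $2(c_p+2d_{\max}-1)$, where $d_{\max}=\max_e d_e$, such that the maximum response time of this schedule is at most twice the optimal maximum response time of a schedule of $I$ (with the original capacities).
   Context: A flow scheduling instance is a switch: a finite set of input ports and output ports, each port $p$ having a positive integer capacity $c_p$, and a finite set $F$ of flows, each flow $e=pq$ going from an input port $p$ to an output port $q$ with a positive integer demand $d_e\le\min(c_p,c_q)$ and a release time $r_e\in\mathbb{N}$ (time is divided into integer rounds). A schedule is a function $\sigma:F\times\mathbb{N}\to\{0,1\}$ such that for every flow $e$ there is some $t$ with $\sigma(e,t)=1$; $\sigma(e,t)=1$ implies $t\ge r_e$; and for every port $p$ and round $t$, $\sum_{e\ni p} d_e\sigma(e,t)\le c_p$ (with the capacities of the instance under consideration). The completion time of $e$ is $C_e=1+\min\{t:\sigma(e,t)=1\}$ and its response time is $\rho_e=C_e-r_e$; the maximum response time of a schedule is $\max_e\rho_e$. An online algorithm learns of each flow only at its release time, and decides which flows to schedule in round $t$ (irrevocably) based only on the flows released at or before round $t$. -}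

module Defs where

open import Data.Nat using (ℕ; zero; suc; _+_; _*_; _∸_; _≤_; _<_; _⊔_; _⊓_; _≤ᵇ_)
open import Data.Bool using (Bool; true; false; if_then_else_; _∧_)
open import Data.Fin using (Fin)
import Data.Fin as Fin
open import Data.List using (List; []; _∷_; length; lookup; tabulate)
open import Data.Nat.ListAction using (sum)
open import Data.Vec using (Vec; []; _∷_; head; tail)
import Data.Vec as Vec
open import Data.Product using (Σ; ∃; _×_; _,_)
open import Data.Sum using (_⊎_)
open import Relation.Nullary using (does)
open import Relation.Binary.PropositionalEquality using (_≡_)

record Flow (a b : ℕ) : Set where
  constructor mkFlow
  field
    src : Fin a
    dst : Fin b
    dem : ℕ
    rel : ℕ
open Flow public

-- A flow scheduling instance: a switch with a input ports and b output
-- ports with capacities, and a finite family of flows (a list; flows are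
-- identified by their position, so identical copies are distinct flows).
record Instance : Set where
  constructor mkInstance
  field
    nIn   : ℕ
    nOut  : ℕ
    capIn  : Fin nIn → ℕ
    capOut : Fin nOut → ℕ
    flows : List (Flow nIn nOut)
open Instance public

Flows : Instance → Set
Flows I = Fin (length (flows I))

flow : (I : Instance) → Flows I → Flow (nIn I) (nOut I)
flow I e = lookup (flows I) e

WellFormed : Instance → Set
WellFormed I =
  (∀ p → 0 < capIn I p) × (∀ q → 0 < capOut I q) ×
  (∀ e → 0 < dem (flow I e)
       × dem (flow I e) ≤ capIn I (src (flow I e)) ⊓ capOut I (dst (flow I e)))

dmax : Instance → ℕ
dmax I = go (flows I)
  where
  go : List (Flow (nIn I) (nOut I)) → ℕ
  go [] = 0
  go (f ∷ fs) = dem f ⊔ go fs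

augment : Instance → Instance
augment I = mkInstance (nIn I) (nOut I)
  (λ p → 2 * (capIn I p + 2 * dmax I ∸ 1))
  (λ q → 2 * (capOut I q + 2 * dmax I ∸ 1))
  (flows I)

Sched : Instance → Set
Sched I = Flows I → ℕ → Bool

loadIn : (I : Instance) → Sched I → Fin (nIn I) → ℕ → ℕ
loadIn I σ p t = sum (tabulate λ e →
  if σ e t ∧ does (src (flow I e) Fin.≟ p) then dem (flow I e) else 0)

loadOut : (I : Instance) → Sched I → Fin (nOut I) → ℕ → ℕ
loadOut I σ q t = sum (tabulate λ e →
  if σ e t ∧ does (dst (flow I e) Fin.≟ q) then dem (flow I e) else 0)

IsSchedule : (I : Instance) → Sched I → Set
IsSchedule I σ =
  (∀ e → ∃ λ t → σ e t ≡ true) ×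
  (∀ e t → σ e t ≡ true → rel (flow I e) ≤ t) ×
  (∀ p t → loadIn I σ p t ≤ capIn I p) ×
  (∀ q t → loadOut I σ q t ≤ capOut I q)

-- t is the first round in which e is scheduled (so C_e = 1 + t).
FirstRound : (I : Instance) → Sched I → Flows I → ℕ → Set
FirstRound I σ e t = σ e t ≡ true × (∀ s → s < t → σ e s ≡ false)

ResponseTime : (I : Instance) → Sched I → Flows I → ℕ → Set
ResponseTime I σ e ρ = ∃ λ t → FirstRound I σ e t × ρ ≡ suc t ∸ rel (flow I e)

MaxResponseTime : (I : Instance) → Sched I → ℕ → Set
MaxResponseTime I σ M =
  (∀ e ρ → ResponseTime I σ e ρ → ρ ≤ M) ×
  ((length (flows I) ≡ 0 × M ≡ 0) ⊎ (∃ λ e → ResponseTime I σ e M))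

known : ∀ {a b} → ℕ → List (Flow a b) → List (Flow a b)
known t [] = []
known t (f ∷ fs) = if rel f ≤ᵇ t then f ∷ known t fs else known t fs

-- An online algorithm: knowing the switch (ports and capacities), in round t
-- it sees only the flows released at or before t and decides which of them
-- to schedule in round t.  (Being deterministic, its earlier decisions are
-- recomputable from this information.)
OnlineAlgorithm : Set
OnlineAlgorithm = (a b : ℕ) → (Fin a → ℕ) → (Fin b → ℕ) → (t : ℕ) →
  (ks : List (Flow a b)) → Vec Bool (length ks)

spread : ∀ {a b} (t : ℕ) (fs : List (Flow a b)) →
  Vec Bool (length (known t fs)) → Vec Bool (length fs)
spread t [] v = []
spread t (f ∷ fs) v with rel f ≤ᵇ t
... | true = head v ∷ spread t fs (tail v)
... | false = false ∷ spread t fs v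

-- The schedule (of the flows of I) produced by running the algorithm on I.
-- Capacities passed to the algorithm are those of the instance it is run on.
run : OnlineAlgorithm → (I : Instance) → Sched I
run A I e t = Vec.lookup
  (spread t (flows I) (A (nIn I) (nOut I) (capIn I) (capOut I) t (known t (flows I)))) e

module Submission where

-- The algorithm works in phases.  Phase k collects the flows released in its
-- window [opening k, closing k) and serves them from round closing k on, by a
-- plan of minimal length L_k (at least 1) that respects the doubled capacities
-- 2c_p; the window of phase k+1 is the service period [closing k, closing k + L_k)
-- of phase k.  As 2c_p ≤ 2(c_p + 2 d_max - 1), the result is a schedule of the
-- augmented instance.  Given any schedule τ of the original instance with maximum
-- response time M, every phase is short, L_k ≤ M: by induction a window has
-- length at most M, so τ serves its batch within 2M rounds, and merging the
-- rounds of τ in consecutive pairs gives a plan of length M at capacity 2c_p.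
-- A flow released during phase k is served before phase k+1 ends, so its
-- response time is at most L_k + L_{k+1} ≤ 2M.

open import Defs
open import Data.Nat using (ℕ; zero; suc; _+_; _*_; _∸_; _≤_; _<_; _≤ᵇ_; _<ᵇ_; _≡ᵇ_; _≤?_; _<?_; z≤n; s≤s; s≤s⁻¹; ⌊_/2⌋)
open import Data.Nat.Properties
  using (*-monoʳ-≤; +-assoc; +-comm; +-identityʳ; +-mono-≤; +-monoʳ-<; +-monoʳ-≤; +-monoˡ-<; +-monoˡ-≤; +-suc; <-cmp; <-irrefl; <-≤-trans; <ᵇ⇒<; <⇒<ᵇ; <⇒≤; allUpTo?; m+[n∸m]≡n; m+n∸m≡n; m+n∸n≡m; m<n⇒0<n∸m; m≤m+n; m≤n+m∸n; m≤n+o⇒m∸n≤o; m≤n⇒m<n∨m≡n; m≤n⇒m≤1+n; n≤1+n; n≮0; ∸-monoˡ-<; ∸-monoˡ-≤; ≡ᵇ⇒≡; ≡⇒≡ᵇ; ≤-antisym; ≤-refl; ≤-reflexive; ≤-trans; ≤ᵇ⇒≤; ≤⇒≤ᵇ; ≮⇒≥; m≤m⊔n; m≤n⊓o⇒m≤n; m≤n⊓o⇒m≤o; +-commutativeSemigroup; module ≤-Reasoning)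
open import Data.Bool using (Bool; true; false; if_then_else_; _∧_; T; T?)
open import Data.Bool.Properties using (T-∧; T-≡)
open import Data.Fin using (Fin; zero; suc; toℕ)
import Data.Fin as Fin
import Data.Fin.Properties as Fin
open import Data.List using (List; []; _∷_; length; lookup; tabulate; filterᵇ; upTo; cartesianProductWith)
open import Data.List.Properties using (tabulate-cong)
open import Data.List.Membership.Propositional using (_∈_; lose)
open import Data.List.Membership.Propositional.Properties using (∈-cartesianProductWith⁺; ∈-upTo⁺; ∈-filter⁻)
open import Data.List.Relation.Unary.Any using (here; there; any?; satisfied)
import Data.List.Relation.Unary.Any as Any
open import Data.List.Relation.Unary.Any.Properties using (lookup-index)
open import Data.Nat.ListAction using (sum)
open import Data.Vec using (Vec; []; _∷_; head; tail)
import Data.Vec as Vec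
import Data.Vec.Properties as Vec
open import Data.Product using (Σ; ∃; _×_; _,_; proj₁; proj₂)
open import Data.Sum using (_⊎_; inj₁; inj₂)
import Data.Sum as Sum
open import Data.Empty using (⊥-elim)
open import Data.Unit using (tt)
open import Function using (_∘_; Equivalence)
open import Relation.Nullary using (Dec; yes; no; does; _×-dec_)
open import Relation.Binary using (tri<; tri≈; tri>)
open import Relation.Binary.PropositionalEquality using (_≡_; refl; sym; trans; cong; cong₂; subst; module ≡-Reasoning)
open import Algebra.Properties.CommutativeSemigroup +-commutativeSemigroup using (interchange)

sum-tabulate-≤ : ∀ {n} (f g h : Fin n → ℕ) → (∀ i → f i ≤ g i + h i) →
  sum (tabulate f) ≤ sum (tabulate g) + sum (tabulate h)
sum-tabulate-≤ {zero} f g h _ = z≤n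
sum-tabulate-≤ {suc n} f g h f≤g+h = begin
  f zero + sum (tabulate (f ∘ suc))
    ≤⟨ +-mono-≤ (f≤g+h zero) (sum-tabulate-≤ (f ∘ suc) (g ∘ suc) (h ∘ suc) (f≤g+h ∘ suc)) ⟩
  (g zero + h zero) + (sum (tabulate (g ∘ suc)) + sum (tabulate (h ∘ suc)))
    ≡⟨ interchange (g zero) (h zero) _ _ ⟩
  sum (tabulate g) + sum (tabulate h) ∎
  where open ≤-Reasoning

halve-cases : ∀ d → d ≡ ⌊ d /2⌋ + ⌊ d /2⌋ ⊎ d ≡ suc (⌊ d /2⌋ + ⌊ d /2⌋)
halve-cases zero = inj₁ refl
halve-cases (suc zero) = inj₂ refl
halve-cases (suc (suc d)) with halve-cases d
... | inj₁ even = inj₁ (cong suc (trans (cong suc even) (sym (+-suc ⌊ d /2⌋ ⌊ d /2⌋))))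
... | inj₂ odd = inj₂ (cong suc (trans (cong suc odd) (cong suc (sym (+-suc ⌊ d /2⌋ ⌊ d /2⌋)))))

halve-< : ∀ d M → d < M + M → ⌊ d /2⌋ < M
halve-< zero (suc M) _ = s≤s z≤n
halve-< (suc zero) (suc M) _ = s≤s z≤n
halve-< (suc (suc d)) (suc M) lt =
  s≤s (halve-< d M (s≤s⁻¹ (subst (suc (suc d) ≤_) (+-suc M M) (s≤s⁻¹ lt))))

-- Halving the distance to l sends exactly the rounds l + 2o and l + 2o + 1 to o;
-- this is how two rounds of a schedule are merged into one.
halve-covers : ∀ {l T o} → l ≤ T → ⌊ (T ∸ l) /2⌋ ≡ o → T ≡ l + (o + o) ⊎ T ≡ suc (l + (o + o))
halve-covers {l} {T} l≤T refl with halve-cases (T ∸ l)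
... | inj₁ even = inj₁ (trans (sym (m+[n∸m]≡n l≤T)) (cong (l +_) even))
... | inj₂ odd = inj₂ (trans (sym (m+[n∸m]≡n l≤T)) (trans (cong (l +_) odd) (+-suc l _)))

least-true : (f : ℕ → Bool) (n : ℕ) → f n ≡ true → ∃ λ t → f t ≡ true × (∀ s → s < t → f s ≡ false)
least-true f zero fn = 0 , fn , λ _ ()
least-true f (suc n) fn with f 0 in f0
... | true = 0 , f0 , λ _ ()
... | false with least-true (f ∘ suc) n fn
...   | t , ft , before = suc t , ft , earlier
  where
  earlier : ∀ s → s < suc t → f s ≡ false
  earlier zero _ = f0
  earlier (suc s) s<t = before s (s≤s⁻¹ s<t)

module _ {a b : ℕ} where
  contribution : ∀ {n} (pt : Flow a b → Fin n) (p : Fin n) (x : Flow a b) (served : Bool) → ℕ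
  contribution pt p x served = if served ∧ does (pt x Fin.≟ p) then dem x else 0

  -- The load of port p when the flows of xs marked by `served` are served;
  -- loadIn/loadOut of Defs are exactly portLoad src/dst of a schedule's round.
  portLoad : ∀ {n} (pt : Flow a b → Fin n) (p : Fin n) (xs : List (Flow a b)) (served : Fin (length xs) → Bool) → ℕ
  portLoad pt p xs served = sum (tabulate λ i → contribution pt p (lookup xs i) (served i))

  roundLoad : ∀ {n} (pt : Flow a b → Fin n) (p : Fin n) (ys : List (Flow a b)) → Vec ℕ (length ys) → ℕ → ℕ
  roundLoad pt p ys v o = portLoad pt p ys (λ i → Vec.lookup v i ≡ᵇ o)

  contribution-≤ : ∀ {n} (pt : Flow a b → Fin n) (cap : Fin n → ℕ) p x served →
    dem x ≤ cap (pt x) → contribution pt p x served ≤ cap p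
  contribution-≤ pt cap p x false _ = z≤n
  contribution-≤ pt cap p x true fits with pt x Fin.≟ p
  ... | yes refl = fits
  ... | no _ = z≤n

  contribution-≤₂ : ∀ {n} (pt : Flow a b → Fin n) p x (s s₁ s₂ : Bool) → (T s → T s₁ ⊎ T s₂) →
    contribution pt p x s ≤ contribution pt p x s₁ + contribution pt p x s₂
  contribution-≤₂ pt p x false s₁ s₂ _ = z≤n
  contribution-≤₂ pt p x true true s₂ _ = m≤m+n _ _
  contribution-≤₂ pt p x true false true _ = ≤-refl
  contribution-≤₂ pt p x true false false covered with covered tt
  ... | inj₁ ()
  ... | inj₂ ()

  portLoad-cong : ∀ {n} (pt : Flow a b → Fin n) p xs {s s′ : Fin (length xs) → Bool} →
    (∀ i → s i ≡ s′ i) → portLoad pt p xs s ≡ portLoad pt p xs s′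
  portLoad-cong pt p xs same = cong sum (tabulate-cong (cong (contribution pt p _) ∘ same))

  portLoad-idle : ∀ {n} (pt : Flow a b → Fin n) p xs → portLoad pt p xs (λ _ → false) ≡ 0
  portLoad-idle pt p [] = refl
  portLoad-idle pt p (x ∷ xs) = portLoad-idle pt p xs

  portLoad-nil : ∀ {n} (pt : Flow a b → Fin n) p {xs} s → xs ≡ [] → portLoad pt p xs s ≡ 0
  portLoad-nil pt p s refl = refl

  -- The flows selected by P form the batch filterᵇ P xs.  `expand` spreads
  -- values indexed by the batch back to all of xs (0 for unselected flows),
  -- `restrict` reads off the values of the selected flows, and `decide` serves
  -- in round o exactly the selected flows whose value (offset) is o.
  expand : (P : Flow a b → Bool) (xs : List (Flow a b)) → Vec ℕ (length (filterᵇ P xs)) → Vec ℕ (length xs)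
  expand P [] v = []
  expand P (x ∷ xs) v with P x
  ... | true  = head v ∷ expand P xs (tail v)
  ... | false = 0 ∷ expand P xs v

  restrict : (P : Flow a b → Bool) (xs : List (Flow a b)) → Vec ℕ (length xs) → Vec ℕ (length (filterᵇ P xs))
  restrict P [] [] = []
  restrict P (x ∷ xs) (w ∷ v) with P x
  ... | true  = w ∷ restrict P xs v
  ... | false = restrict P xs v

  decide : (P : Flow a b → Bool) (o : ℕ) (xs : List (Flow a b)) → Vec ℕ (length (filterᵇ P xs)) → Vec Bool (length xs)
  decide P o [] v = []
  decide P o (x ∷ xs) v with P x
  ... | true  = (head v ≡ᵇ o) ∷ decide P o xs (tail v)
  ... | false = false ∷ decide P o xs v

  lookup-decide : ∀ P o xs v e →
    Vec.lookup (decide P o xs v) e ≡ P (lookup xs e) ∧ (Vec.lookup (expand P xs v) e ≡ᵇ o)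
  lookup-decide P o (x ∷ xs) v zero with P x
  ... | true  = refl
  ... | false = refl
  lookup-decide P o (x ∷ xs) v (suc e) with P x
  ... | true  = lookup-decide P o xs (tail v) e
  ... | false = lookup-decide P o xs v e

  expand-all : ∀ (Q : ℕ → Set) P xs v → (∀ i → Q (Vec.lookup v i)) →
    ∀ e → T (P (lookup xs e)) → Q (Vec.lookup (expand P xs v) e)
  expand-all Q P (x ∷ xs) v all zero selected with P x
  expand-all Q P (x ∷ xs) (w ∷ v) all zero _ | true = all zero
  ... | false = ⊥-elim selected
  expand-all Q P (x ∷ xs) v all (suc e) selected with P x
  expand-all Q P (x ∷ xs) (w ∷ v) all (suc e) selected | true = expand-all Q P xs v (all ∘ suc) e selected
  ... | false = expand-all Q P xs v all e selected

  restrict-all : ∀ (Q : ℕ → Set) P xs v → (∀ e → T (P (lookup xs e)) → Q (Vec.lookup v e)) →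
    ∀ i → Q (Vec.lookup (restrict P xs v) i)
  restrict-all Q P (x ∷ xs) (w ∷ v) all i with P x in selected
  restrict-all Q P (x ∷ xs) (w ∷ v) all zero | true = all zero (subst T (sym selected) tt)
  restrict-all Q P (x ∷ xs) (w ∷ v) all (suc i) | true = restrict-all Q P xs v (all ∘ suc) i
  ... | false = restrict-all Q P xs v (all ∘ suc) i

  decide-load : ∀ {n} (pt : Flow a b → Fin n) p P o xs v →
    portLoad pt p xs (Vec.lookup (decide P o xs v)) ≡ roundLoad pt p (filterᵇ P xs) v o
  decide-load pt p P o [] v = refl
  decide-load pt p P o (x ∷ xs) v with P x
  decide-load pt p P o (x ∷ xs) (w ∷ v) | true = cong (_ +_) (decide-load pt p P o xs v)
  ... | false = decide-load pt p P o xs v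

  restrict-load : ∀ {n} (pt : Flow a b → Fin n) p P o xs v →
    roundLoad pt p (filterᵇ P xs) (restrict P xs v) o ≡ portLoad pt p xs (λ e → P (lookup xs e) ∧ (Vec.lookup v e ≡ᵇ o))
  restrict-load pt p P o [] [] = refl
  restrict-load pt p P o (x ∷ xs) (w ∷ v) with P x
  ... | true  = cong (_ +_) (restrict-load pt p P o xs v)
  ... | false = restrict-load pt p P o xs v

  -- A batch consisting of flows released by round t is already visible to an
  -- online algorithm at round t.
  filter-known : ∀ (P : Flow a b → Bool) t xs → (∀ x → T (P x) → rel x ≤ t) → filterᵇ P (known t xs) ≡ filterᵇ P xs
  filter-known P t [] early = refl
  filter-known P t (x ∷ xs) early with rel x ≤ᵇ t in released
  ... | true with P x
  ...   | true  = cong (x ∷_) (filter-known P t xs early)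
  ...   | false = filter-known P t xs early
  filter-known P t (x ∷ xs) early | false with P x in selected
  ...   | false = filter-known P t xs early
  ...   | true  = ⊥-elim (subst T released (≤⇒≤ᵇ (early x (subst T (sym selected) tt))))

  decide-known : ∀ (P : Flow a b → Bool) o t xs → (∀ x → T (P x) → rel x ≤ t) → (g : (ys : List (Flow a b)) → Vec ℕ (length ys)) →
    spread t xs (decide P o (known t xs) (g (filterᵇ P (known t xs)))) ≡ decide P o xs (g (filterᵇ P xs))
  decide-known P o t [] early g = refl
  decide-known P o t (x ∷ xs) early g with rel x ≤ᵇ t in released
  ... | true with P x
  ...   | true  = cong₂ _∷_ (cong (λ ys → head (g (x ∷ ys)) ≡ᵇ o) (filter-known P t xs early))
                            (decide-known P o t xs early (tail ∘ g ∘ (x ∷_)))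
  ...   | false = cong (false ∷_) (decide-known P o t xs early g)
  decide-known P o t (x ∷ xs) early g | false with P x in selected
  ...   | false = cong (false ∷_) (decide-known P o t xs early g)
  ...   | true  = ⊥-elim (subst T released (≤⇒≤ᵇ (early x (subst T (sym selected) tt))))

-- The shortest plan is
-- found by exhaustive search over all offset vectors, trying 1, 2, … rounds;
-- serving one flow per round always works when every flow fits alone.
module Solver {a b : ℕ} (ci : Fin a → ℕ) (co : Fin b → ℕ) where

  RoundFits : (ys : List (Flow a b)) → Vec ℕ (length ys) → ℕ → Set
  RoundFits ys v o = (∀ p → roundLoad src p ys v o ≤ ci p) × (∀ q → roundLoad dst q ys v o ≤ co q)

  Fits : ℕ → (ys : List (Flow a b)) → Vec ℕ (length ys) → Set
  Fits L ys v = (∀ i → Vec.lookup v i < L) × (∀ {o} → o < L → RoundFits ys v o)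

  fits? : ∀ L (ys : List (Flow a b)) v → Dec (Fits L ys v)
  fits? L ys v = Fin.all? (λ i → Vec.lookup v i <? L) ×-dec allUpTo? {P = RoundFits ys v} roundFits? L
    where
    roundFits? : ∀ o → Dec (RoundFits ys v o)
    roundFits? o = Fin.all? (λ p → roundLoad src p ys v o ≤? ci p) ×-dec Fin.all? (λ q → roundLoad dst q ys v o ≤? co q)

  vectorsBelow : ℕ → (n : ℕ) → List (Vec ℕ n)
  vectorsBelow L zero = [] ∷ []
  vectorsBelow L (suc n) = cartesianProductWith _∷_ (upTo L) (vectorsBelow L n)

  ∈-vectorsBelow : ∀ {L n} (v : Vec ℕ n) → (∀ i → Vec.lookup v i < L) → v ∈ vectorsBelow L n
  ∈-vectorsBelow [] _ = here refl
  ∈-vectorsBelow (w ∷ v) below = ∈-cartesianProductWith⁺ _∷_ (∈-upTo⁺ (below zero)) (∈-vectorsBelow v (below ∘ suc))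

  record Plan (ys : List (Flow a b)) : Set where
    constructor plan
    field
      duration : ℕ
      offsets  : Vec ℕ (length ys)
  open Plan public

  sequential : ∀ (ys : List (Flow a b)) → Vec ℕ (length ys)
  sequential ys = Vec.tabulate toℕ

  shortestFrom : ∀ (ys : List (Flow a b)) → (L fuel : ℕ) → Plan ys
  shortestFrom ys L zero = plan L (sequential ys)
  shortestFrom ys L (suc fuel) with any? (fits? L ys) (vectorsBelow L (length ys))
  ... | yes found = plan L (proj₁ (satisfied found))
  ... | no _      = shortestFrom ys (suc L) fuel

  -- The shortest plan of positive length (a batch with n flows needs at most n rounds).
  shortest : ∀ (ys : List (Flow a b)) → Plan ys
  shortest ys = shortestFrom ys 1 (length ys)

  FitAlone : List (Flow a b) → Set
  FitAlone ys = ∀ {y} → y ∈ ys → dem y ≤ ci (src y) × dem y ≤ co (dst y)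

  one-per-round : ∀ {n} (pt : Flow a b → Fin n) (cap : Fin n → ℕ) (ys : List (Flow a b)) →
    (∀ {y} → y ∈ ys → dem y ≤ cap (pt y)) →
    ∀ p o → portLoad pt p ys (λ i → toℕ i ≡ᵇ o) ≤ cap p
  one-per-round pt cap [] fit p o = z≤n
  one-per-round pt cap (y ∷ ys) fit p zero = begin
    contribution pt p y true + portLoad pt p ys (λ _ → false)
      ≡⟨ cong (_ +_) (portLoad-idle pt p ys) ⟩
    contribution pt p y true + 0
      ≡⟨ +-identityʳ _ ⟩
    contribution pt p y true
      ≤⟨ contribution-≤ pt cap p y true (fit (here refl)) ⟩
    cap p ∎
    where open ≤-Reasoning
  one-per-round pt cap (y ∷ ys) fit p (suc o) = one-per-round pt cap ys (fit ∘ there) p o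

  sequential-fits : ∀ L (ys : List (Flow a b)) → FitAlone ys → length ys ≤ L → Fits L ys (sequential ys)
  sequential-fits L ys alone n≤L = bounded , λ {o} _ → load src ci (proj₁ ∘ alone) {o} , load dst co (proj₂ ∘ alone) {o}
    where
    bounded : ∀ i → Vec.lookup (sequential ys) i < L
    bounded i = subst (_< L) (sym (Vec.lookup∘tabulate toℕ i)) (<-≤-trans (Fin.toℕ<n i) n≤L)
    load : ∀ {n} (pt : Flow a b → Fin n) (cap : Fin n → ℕ) → (∀ {y} → y ∈ ys → dem y ≤ cap (pt y)) →
      ∀ {o} p → roundLoad pt p ys (sequential ys) o ≤ cap p
    load pt cap fit {o} p = subst (_≤ cap p)
      (portLoad-cong pt p ys (λ i → cong (_≡ᵇ o) (sym (Vec.lookup∘tabulate toℕ i))))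
      (one-per-round pt cap ys fit p o)

  shortestFrom-≥ : ∀ (ys : List (Flow a b)) L fuel → L ≤ duration (shortestFrom ys L fuel)
  shortestFrom-≥ ys L zero = ≤-refl
  shortestFrom-≥ ys L (suc fuel) with any? (fits? L ys) (vectorsBelow L (length ys))
  ... | yes _ = ≤-refl
  ... | no _  = ≤-trans (n≤1+n L) (shortestFrom-≥ ys (suc L) fuel)

  shortestFrom-fits : ∀ (ys : List (Flow a b)) L fuel → FitAlone ys → length ys ≤ L + fuel →
    Fits (duration (shortestFrom ys L fuel)) ys (offsets (shortestFrom ys L fuel))
  shortestFrom-fits ys L zero alone n≤L = sequential-fits L ys alone (subst (length ys ≤_) (+-identityʳ L) n≤L)
  shortestFrom-fits ys L (suc fuel) alone n≤L with any? (fits? L ys) (vectorsBelow L (length ys))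
  ... | yes found = proj₂ (satisfied found)
  ... | no _      = shortestFrom-fits ys (suc L) fuel alone (subst (length ys ≤_) (+-suc L fuel) n≤L)

  shortestFrom-min : ∀ (ys : List (Flow a b)) L fuel {L′ v} → L ≤ L′ → Fits L′ ys v → duration (shortestFrom ys L fuel) ≤ L′
  shortestFrom-min ys L zero L≤L′ _ = L≤L′
  shortestFrom-min ys L (suc fuel) {L′} {v} L≤L′ fits with any? (fits? L ys) (vectorsBelow L (length ys))
  ... | yes _ = L≤L′
  ... | no none with m≤n⇒m<n∨m≡n L≤L′
  ...   | inj₁ L<L′ = shortestFrom-min ys (suc L) fuel {L′} {v} L<L′ fits
  ...   | inj₂ refl = ⊥-elim (none (lose (∈-vectorsBelow v (proj₁ fits)) fits))

  shortest-pos : ∀ (ys : List (Flow a b)) → 1 ≤ duration (shortest ys)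
  shortest-pos ys = shortestFrom-≥ ys 1 (length ys)

  shortest-fits : ∀ (ys : List (Flow a b)) → FitAlone ys → Fits (duration (shortest ys)) ys (offsets (shortest ys))
  shortest-fits ys alone = shortestFrom-fits ys 1 (length ys) alone (n≤1+n _)

  shortest-min : ∀ (ys : List (Flow a b)) {L v} → 1 ≤ L → Fits L ys v → duration (shortest ys) ≤ L
  shortest-min ys {L} {v} = shortestFrom-min ys 1 (length ys) {L} {v}

releasedIn : ∀ {a b} → ℕ → ℕ → Flow a b → Bool
releasedIn l s x = (l ≤ᵇ rel x) ∧ (rel x <ᵇ s)

releasedIn⇒ : ∀ {a b} l s (x : Flow a b) → T (releasedIn l s x) → l ≤ rel x × rel x < s
releasedIn⇒ l s x r with Equivalence.to T-∧ r
... | l≤r , r<s = ≤ᵇ⇒≤ l (rel x) l≤r , <ᵇ⇒< (rel x) s r<s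

releasedIn⇐ : ∀ {a b} l s (x : Flow a b) → l ≤ rel x → rel x < s → T (releasedIn l s x)
releasedIn⇐ l s x l≤r r<s = Equivalence.from T-∧ (≤⇒≤ᵇ l≤r , <⇒<ᵇ r<s)

module Phases (len : ℕ → ℕ → ℕ) where
  -- Window of phase k; phase 0 has the empty window and lasts len 0 0 rounds.
  mutual
    opening : ℕ → ℕ
    opening zero = 0
    opening (suc k) = closing k

    closing : ℕ → ℕ
    closing zero = 0
    closing (suc k) = closing k + len (opening k) (closing k)

  phaseLength : ℕ → ℕ
  phaseLength k = len (opening k) (closing k)

  current : ℕ → ℕ
  current zero = 0
  current (suc t) = if suc t <ᵇ closing (suc (current t)) then current t else suc (current t)

  -- With positive lengths the closings increase strictly, so every round lies
  -- in exactly one service period.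
  module Increasing (len-pos : ∀ l s → 1 ≤ len l s) where
    closing-< : ∀ k → closing k < closing (suc k)
    closing-< k = subst (_≤ closing (suc k)) (+-comm (closing k) 1) (+-monoʳ-≤ (closing k) (len-pos _ _))

    closing-mono : ∀ {j k} → j ≤ k → closing j ≤ closing k
    closing-mono {k = zero} z≤n = ≤-refl
    closing-mono {k = suc k} j≤k with m≤n⇒m<n∨m≡n j≤k
    ... | inj₁ j<k  = ≤-trans (closing-mono (s≤s⁻¹ j<k)) (<⇒≤ (closing-< k))
    ... | inj₂ refl = ≤-refl

    current-spec : ∀ t → closing (current t) ≤ t × t < closing (suc (current t))
    current-spec zero = z≤n , closing-< 0
    current-spec (suc t) with suc t <ᵇ closing (suc (current t)) in before
    ... | true  = m≤n⇒m≤1+n (proj₁ (current-spec t)) , <ᵇ⇒< _ _ (subst T (sym before) tt)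
    ... | false = ≤-reflexive reached , subst (_< closing (suc (suc (current t)))) reached (closing-< (suc (current t)))
      where
      reached : closing (suc (current t)) ≡ suc t
      reached = ≤-antisym (≮⇒≥ (λ lt → subst T before (<⇒<ᵇ lt))) (proj₂ (current-spec t))

    current-unique : ∀ {k t} → closing k ≤ t → t < closing (suc k) → current t ≡ k
    current-unique {k} {t} k≤t t<k′ with <-cmp (current t) k
    ... | tri< c<k _ _ = ⊥-elim (<-irrefl refl (<-≤-trans (proj₂ (current-spec t)) (≤-trans (closing-mono c<k) k≤t)))
    ... | tri≈ _ c≡k _ = c≡k
    ... | tri> _ _ k<c = ⊥-elim (<-irrefl refl (<-≤-trans t<k′ (≤-trans (closing-mono k<c) (proj₁ (current-spec t)))))

-- Two length functions that agree on every window closing by round t induce the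
-- same phases up to round t.  The online algorithm is run on the flows known at
-- round t, whose batches (hence lengths) agree with the full ones on such windows.
module Agreement (len len′ : ℕ → ℕ → ℕ) (t : ℕ) (agree : ∀ l s → s ≤ t → len′ l s ≡ len l s) where
  private
    module P = Phases len
    module P′ = Phases len′

  mutual
    bounds-agree : ∀ k → P.closing k ≤ t → P′.opening k ≡ P.opening k × P′.closing k ≡ P.closing k
    bounds-agree zero _ = refl , refl
    bounds-agree (suc k) k′≤t = proj₂ (bounds-agree k k≤t) , next-agree k k≤t
      where k≤t = ≤-trans (m≤m+n (P.closing k) _) k′≤t

    next-agree : ∀ k → P.closing k ≤ t → P′.closing (suc k) ≡ P.closing (suc k)
    next-agree k k≤t with bounds-agree k k≤t
    ... | same-opening , same-closing rewrite same-opening | same-closing =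
      cong (P.closing k +_) (agree (P.opening k) (P.closing k) k≤t)

  current-agree : (∀ l s → 1 ≤ len l s) → ∀ t′ → t′ ≤ t → P′.current t′ ≡ P.current t′
  current-agree pos zero _ = refl
  current-agree pos (suc t′) t′<t
    rewrite current-agree pos t′ (≤-trans (n≤1+n t′) t′<t)
          | next-agree (P.current t′) (≤-trans (proj₁ (P.Increasing.current-spec pos t′)) (≤-trans (n≤1+n t′) t′<t)) = refl

module Algorithm {a b : ℕ} (ci : Fin a → ℕ) (co : Fin b → ℕ) where
  open Solver (λ p → 2 * ci p) (λ q → 2 * co q) public

  batch : ℕ → ℕ → List (Flow a b) → List (Flow a b)
  batch l s = filterᵇ (releasedIn l s)

  batchLength : List (Flow a b) → ℕ → ℕ → ℕ
  batchLength xs l s = duration (shortest (batch l s xs))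

  serve : (xs : List (Flow a b)) → ℕ → Vec Bool (length xs)
  serve xs t = decide (releasedIn l s) (t ∸ s) xs (offsets (shortest (batch l s xs)))
    where
    open Phases (batchLength xs)
    l = opening (current t)
    s = closing (current t)

  batchLength-pos : ∀ xs l s → 1 ≤ batchLength xs l s
  batchLength-pos xs l s = shortest-pos (batch l s xs)

  -- Running the algorithm on the flows known at round t decides the same as
  -- running it on all flows: only windows closing by round t matter.
  module Online (t : ℕ) (xs : List (Flow a b)) where
    early : ∀ l s → s ≤ t → ∀ (x : Flow a b) → T (releasedIn l s x) → rel x ≤ t
    early l s s≤t x r = ≤-trans (<⇒≤ (proj₂ (releasedIn⇒ l s x r))) s≤t

    open Agreement (batchLength xs) (batchLength (known t xs)) t
      (λ l s s≤t → cong (duration ∘ shortest) (filter-known (releasedIn l s) t xs (early l s s≤t)))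
    open Phases (batchLength xs)
    open Increasing (batchLength-pos xs)

    serve-online : spread t xs (serve (known t xs) t) ≡ serve xs t
    serve-online
      rewrite current-agree (batchLength-pos xs) t ≤-refl
            | proj₁ (bounds-agree (current t) (proj₁ (current-spec t)))
            | proj₂ (bounds-agree (current t) (proj₁ (current-spec t)))
      = decide-known (releasedIn l s) (t ∸ s) t xs (early l s (proj₁ (current-spec t))) (offsets ∘ shortest)
      where
      l = opening (current t)
      s = closing (current t)

algorithm : OnlineAlgorithm
algorithm a b ci co t ks = Algorithm.serve ci co ks t

run-algorithm : ∀ I e t → run algorithm I e t ≡ Vec.lookup (Algorithm.serve (capIn I) (capOut I) (flows I) t) e
run-algorithm I e t = cong (λ v → Vec.lookup v e) (Algorithm.Online.serve-online (capIn I) (capOut I) t (flows I))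

fits-alone : ∀ I → WellFormed I → ∀ {y} → y ∈ flows I → dem y ≤ capIn I (src y) × dem y ≤ capOut I (dst y)
fits-alone I (_ , _ , demands) y∈ =
  subst (λ z → dem z ≤ capIn I (src z) × dem z ≤ capOut I (dst z)) (sym (lookup-index y∈))
    (m≤n⊓o⇒m≤n _ _ d≤c , m≤n⊓o⇒m≤o _ _ d≤c)
  where d≤c = proj₂ (demands (Any.index y∈))

dmax-pos : ∀ I → WellFormed I → flows I ≡ [] ⊎ 1 ≤ dmax I
dmax-pos (mkInstance _ _ _ _ []) _ = inj₁ refl
dmax-pos (mkInstance _ _ _ _ (f ∷ _)) (_ , _ , demands) = inj₂ (≤-trans (proj₁ (demands zero)) (m≤m⊔n (dem f) _))

augment-≥ : ∀ c d → 1 ≤ d → 2 * c ≤ 2 * (c + 2 * d ∸ 1)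
augment-≥ c d d≥1 = *-monoʳ-≤ 2 (subst (_≤ c + 2 * d ∸ 1) (m+n∸n≡m c 1)
  (∸-monoˡ-≤ 1 (+-monoʳ-≤ c (≤-trans d≥1 (m≤m+n d _)))))

within-augmented : ∀ I → WellFormed I → ∀ {n} (pt : Flow (nIn I) (nOut I) → Fin n) p served c →
  portLoad pt p (flows I) served ≤ 2 * c → portLoad pt p (flows I) served ≤ 2 * (c + 2 * dmax I ∸ 1)
within-augmented I wf pt p served c load≤ with dmax-pos I wf
... | inj₁ none = subst (_≤ _) (sym (portLoad-nil pt p served none)) z≤n
... | inj₂ d≥1 = ≤-trans load≤ (augment-≥ c (dmax I) d≥1)

module Run (I : Instance) (wf : WellFormed I) where
  open Algorithm (capIn I) (capOut I)
  open Phases (batchLength (flows I))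
  open Increasing (batchLength-pos (flows I))

  schedule : Sched I
  schedule = run algorithm I

  inPhase : ℕ → Flow (nIn I) (nOut I) → Bool
  inPhase k = releasedIn (opening k) (closing k)

  phaseBatch : ℕ → List (Flow (nIn I) (nOut I))
  phaseBatch k = batch (opening k) (closing k) (flows I)

  offsetIn : ℕ → Vec ℕ (length (flows I))
  offsetIn k = expand (inPhase k) (flows I) (offsets (shortest (phaseBatch k)))

  phaseOf : Flows I → ℕ
  phaseOf e = suc (current (rel (flow I e)))

  servedAt : Flows I → ℕ
  servedAt e = closing (phaseOf e) + Vec.lookup (offsetIn (phaseOf e)) e

  phase-fits : ∀ k → Fits (phaseLength k) (phaseBatch k) (offsets (shortest (phaseBatch k)))
  phase-fits k = shortest-fits (phaseBatch k) alone
    where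
    alone : FitAlone (phaseBatch k)
    alone y∈ with fits-alone I wf (proj₁ (∈-filter⁻ (T? ∘ inPhase k) {xs = flows I} y∈))
    ... | d≤ci , d≤co = ≤-trans d≤ci (m≤m+n _ _) , ≤-trans d≤co (m≤m+n _ _)

  schedule-lookup : ∀ e t → schedule e t ≡
    inPhase (current t) (flow I e) ∧ (Vec.lookup (offsetIn (current t)) e ≡ᵇ t ∸ closing (current t))
  schedule-lookup e t = trans (run-algorithm I e t) (lookup-decide _ _ (flows I) _ e)

  in-phaseOf : ∀ e → T (inPhase (phaseOf e) (flow I e))
  in-phaseOf e = releasedIn⇐ _ _ (flow I e) (proj₁ (current-spec _)) (proj₂ (current-spec _))

  phaseOf-unique : ∀ e k → T (inPhase k (flow I e)) → k ≡ phaseOf e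
  phaseOf-unique e zero r = ⊥-elim (n≮0 (proj₂ (releasedIn⇒ 0 0 (flow I e) r)))
  phaseOf-unique e (suc k) r with releasedIn⇒ (closing k) (closing (suc k)) (flow I e) r
  ... | k≤r , r<k′ = cong suc (sym (current-unique k≤r r<k′))

  servedAt-in-phase : ∀ e → closing (phaseOf e) ≤ servedAt e × servedAt e < closing (suc (phaseOf e))
  servedAt-in-phase e = m≤m+n _ _ , +-monoʳ-< (closing (phaseOf e)) offset<
    where
    offset< : Vec.lookup (offsetIn (phaseOf e)) e < phaseLength (phaseOf e)
    offset< = expand-all (_< phaseLength (phaseOf e)) (inPhase (phaseOf e)) (flows I) _
                (proj₁ (phase-fits (phaseOf e))) e (in-phaseOf e)

  served-once : ∀ e t → schedule e t ≡ true → t ≡ servedAt e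
  served-once e t served with Equivalence.to T-∧ (subst T (trans (sym served) (schedule-lookup e t)) tt)
  ... | selected , on-offset = begin
    t                                                      ≡⟨ m+[n∸m]≡n (proj₁ (current-spec t)) ⟨
    closing c + (t ∸ closing c)                                ≡⟨ cong (closing c +_) (≡ᵇ⇒≡ _ _ on-offset) ⟨
    closing c + Vec.lookup (offsetIn c) e                    ≡⟨ cong (λ k → closing k + Vec.lookup (offsetIn k) e) (phaseOf-unique e c selected) ⟩
    servedAt e                                             ∎
    where
    open ≡-Reasoning
    c = current t

  served-at : ∀ e → schedule e (servedAt e) ≡ true
  served-at e = begin
    schedule e (servedAt e)
      ≡⟨ schedule-lookup e (servedAt e) ⟩
    inPhase c (flow I e) ∧ (Vec.lookup (offsetIn c) e ≡ᵇ servedAt e ∸ closing c)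
      ≡⟨ cong (λ k → inPhase k (flow I e) ∧ (Vec.lookup (offsetIn k) e ≡ᵇ servedAt e ∸ closing k)) c≡k ⟩
    inPhase k (flow I e) ∧ (offset ≡ᵇ closing k + offset ∸ closing k)
      ≡⟨ cong (λ n → inPhase k (flow I e) ∧ (offset ≡ᵇ n)) (m+n∸m≡n (closing k) offset) ⟩
    inPhase k (flow I e) ∧ (offset ≡ᵇ offset)
      ≡⟨ cong₂ _∧_ (Equivalence.to T-≡ (in-phaseOf e)) (Equivalence.to T-≡ (≡⇒≡ᵇ offset offset refl)) ⟩
    true ∎
    where
    open ≡-Reasoning
    k = phaseOf e
    c = current (servedAt e)
    offset = Vec.lookup (offsetIn k) e
    c≡k : c ≡ k
    c≡k = current-unique (proj₁ (servedAt-in-phase e)) (proj₂ (servedAt-in-phase e))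

  schedule-load : ∀ {n} (pt : Flow (nIn I) (nOut I) → Fin n) p t →
    portLoad pt p (flows I) (λ e → schedule e t) ≡
    roundLoad pt p (phaseBatch (current t)) (offsets (shortest (phaseBatch (current t)))) (t ∸ closing (current t))
  schedule-load pt p t = trans (portLoad-cong pt p (flows I) (λ e → run-algorithm I e t))
                               (decide-load pt p (inPhase (current t)) (t ∸ closing (current t)) (flows I) _)

  round-fits : ∀ t → RoundFits (phaseBatch (current t)) (offsets (shortest (phaseBatch (current t)))) (t ∸ closing (current t))
  round-fits t = proj₂ (phase-fits c) (subst (t ∸ closing c <_) (m+n∸m≡n (closing c) (phaseLength c))
                                         (∸-monoˡ-< (proj₂ (current-spec t)) (proj₁ (current-spec t))))
    where c = current t

  is-schedule : IsSchedule (augment I) schedule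
  is-schedule = (λ e → servedAt e , served-at e) , released , in-capacity , out-capacity
    where
    released : ∀ e t → schedule e t ≡ true → rel (flow I e) ≤ t
    released e t served = subst (rel (flow I e) ≤_) (sym (served-once e t served))
      (≤-trans (<⇒≤ (proj₂ (current-spec _))) (proj₁ (servedAt-in-phase e)))
    in-capacity : ∀ p t → loadIn (augment I) schedule p t ≤ 2 * (capIn I p + 2 * dmax I ∸ 1)
    in-capacity p t = within-augmented I wf src p _ (capIn I p)
      (subst (_≤ 2 * capIn I p) (sym (schedule-load src p t)) (proj₁ (round-fits t) p))
    out-capacity : ∀ q t → loadOut (augment I) schedule q t ≤ 2 * (capOut I q + 2 * dmax I ∸ 1)
    out-capacity q t = within-augmented I wf dst q _ (capOut I q)
      (subst (_≤ 2 * capOut I q) (sym (schedule-load dst q t)) (proj₂ (round-fits t) q))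

  response-bound : ∀ {M} → (∀ k → phaseLength k ≤ M) → ∀ e → suc (servedAt e) ∸ rel (flow I e) ≤ 2 * M
  response-bound {M} short e = m≤n+o⇒m∸n≤o (suc (servedAt e)) r (begin
    suc (servedAt e)                  ≤⟨ proj₂ (servedAt-in-phase e) ⟩
    closing k + phaseLength k         ≤⟨ +-monoʳ-≤ (closing k) (short k) ⟩
    (closing c + phaseLength c) + M   ≤⟨ +-monoˡ-≤ M (+-mono-≤ (proj₁ (current-spec r)) (short c)) ⟩
    (r + M) + M                       ≡⟨ +-assoc r M M ⟩
    r + (M + M)                       ≡⟨ cong (λ m → r + (M + m)) (+-identityʳ M) ⟨
    r + 2 * M                         ∎)
    where
    open ≤-Reasoning
    r = rel (flow I e)
    c = current r
    k = phaseOf e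

  module Versus (τ : Sched I) (τ-schedule : IsSchedule I τ) (M : ℕ) (τ-max : MaxResponseTime I τ M) where
    first : ∀ e → ∃ λ t → FirstRound I τ e t
    first e = least-true (τ e) _ (proj₂ (proj₁ τ-schedule e))

    τ-time : Flows I → ℕ
    τ-time e = proj₁ (first e)

    τ-serves : ∀ e → T (τ e (τ-time e))
    τ-serves e = Equivalence.from T-≡ (proj₁ (proj₂ (first e)))

    τ-response : ∀ e → suc (τ-time e) ∸ rel (flow I e) ≤ M
    τ-response e = proj₁ τ-max e _ (τ-time e , proj₂ (first e) , refl)

    τ-window : ∀ e → rel (flow I e) ≤ τ-time e × τ-time e < rel (flow I e) + M
    τ-window e = proj₁ (proj₂ τ-schedule) e (τ-time e) (proj₁ (proj₂ (first e))) ,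
      ≤-trans (m≤n+m∸n _ (rel (flow I e))) (+-monoʳ-≤ (rel (flow I e)) (τ-response e))

    -- Response times are positive, so M ≥ 1 as soon as there is a flow.
    M-pos : Flows I → 1 ≤ M
    M-pos e = ≤-trans (m<n⇒0<n∸m (s≤s (proj₁ (τ-window e)))) (τ-response e)

    -- Merge the rounds of τ in pairs, counting from round l.
    compressed : ℕ → Vec ℕ (length (flows I))
    compressed l = Vec.tabulate (λ e → ⌊ (τ-time e ∸ l) /2⌋)

    compressed-covers : ∀ l s o e → T (releasedIn l s (flow I e) ∧ (Vec.lookup (compressed l) e ≡ᵇ o)) →
      T (τ e (l + (o + o))) ⊎ T (τ e (suc (l + (o + o))))
    compressed-covers l s o e selected with Equivalence.to T-∧ selected
    ... | released , on-offset =
      Sum.map (λ even → subst (T ∘ τ e) even (τ-serves e)) (λ odd → subst (T ∘ τ e) odd (τ-serves e))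
        (halve-covers (≤-trans (proj₁ (releasedIn⇒ l s (flow I e) released)) (proj₁ (τ-window e)))
                      (trans (sym (Vec.lookup∘tabulate _ e)) (≡ᵇ⇒≡ _ _ on-offset)))

    -- The batch of a window of length at most M has a plan of M rounds at
    -- doubled capacity: the merged rounds of τ.
    batch-compressible : ∀ l s → s ≤ l + M → Fits M (batch l s (flows I)) (restrict (releasedIn l s) (flows I) (compressed l))
    batch-compressible l s s≤l+M = bounded , λ {o} _ →
        load src (capIn I) (proj₁ (proj₂ (proj₂ τ-schedule))) {o} ,
        load dst (capOut I) (proj₂ (proj₂ (proj₂ τ-schedule))) {o}
      where
      bounded : ∀ i → Vec.lookup (restrict (releasedIn l s) (flows I) (compressed l)) i < M
      bounded = restrict-all (_< M) (releasedIn l s) (flows I) (compressed l) λ e selected →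
        let (l≤r , r<s) = releasedIn⇒ l s (flow I e) selected
            (r≤T , T<r+M) = τ-window e
            T<l+2M = begin-strict
              τ-time e             <⟨ T<r+M ⟩
              rel (flow I e) + M   <⟨ +-monoˡ-< M r<s ⟩
              s + M                ≤⟨ +-monoˡ-≤ M s≤l+M ⟩
              l + M + M            ≡⟨ +-assoc l M M ⟩
              l + (M + M)          ∎
        in subst (_< M) (sym (Vec.lookup∘tabulate _ e))
             (halve-< _ M (subst (τ-time e ∸ l <_) (m+n∸m≡n l (M + M)) (∸-monoˡ-< T<l+2M (≤-trans l≤r r≤T))))
        where open ≤-Reasoning
      load : ∀ {n} (pt : Flow (nIn I) (nOut I) → Fin n) (cap : Fin n → ℕ) →
        (∀ p t → portLoad pt p (flows I) (λ e → τ e t) ≤ cap p) →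
        ∀ {o} p → roundLoad pt p (batch l s (flows I)) (restrict (releasedIn l s) (flows I) (compressed l)) o ≤ 2 * cap p
      load pt cap τ-fits {o} p = begin
        roundLoad pt p (batch l s (flows I)) (restrict (releasedIn l s) (flows I) (compressed l)) o
          ≡⟨ restrict-load pt p (releasedIn l s) o (flows I) (compressed l) ⟩
        portLoad pt p (flows I) (λ e → releasedIn l s (flow I e) ∧ (Vec.lookup (compressed l) e ≡ᵇ o))
          ≤⟨ sum-tabulate-≤ _ _ _ (λ e → contribution-≤₂ pt p (flow I e) _ _ _ (compressed-covers l s o e)) ⟩
        portLoad pt p (flows I) (λ e → τ e (l + (o + o))) + portLoad pt p (flows I) (λ e → τ e (suc (l + (o + o))))
          ≤⟨ +-mono-≤ (τ-fits p _) (τ-fits p _) ⟩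
        cap p + cap p
          ≡⟨ cong (cap p +_) (+-identityʳ (cap p)) ⟨
        2 * cap p ∎
        where open ≤-Reasoning

    mutual
      phase-short : 1 ≤ M → ∀ k → phaseLength k ≤ M
      phase-short pos k = shortest-min (phaseBatch k) {M} {restrict (inPhase k) (flows I) (compressed (opening k))} pos
        (batch-compressible (opening k) (closing k) (closing-near pos k))

      closing-near : 1 ≤ M → ∀ k → closing k ≤ opening k + M
      closing-near pos zero = z≤n
      closing-near pos (suc k) = +-monoʳ-≤ (closing k) (phase-short pos k)

  competitive : (τ : Sched I) → IsSchedule I τ → (M Mτ : ℕ) →
    MaxResponseTime (augment I) schedule M → MaxResponseTime I τ Mτ → M ≤ 2 * Mτ
  competitive τ τ-schedule M Mτ (_ , inj₁ (_ , refl)) τ-max = z≤n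
  competitive τ τ-schedule M Mτ (_ , inj₂ (e , t , (served , _) , refl)) τ-max
    rewrite served-once e t served = response-bound (phase-short (M-pos e)) e
    where open Versus τ τ-schedule Mτ τ-max

lemma5p3 : Σ OnlineAlgorithm λ A →
    (I : Instance) → WellFormed I →
    IsSchedule (augment I) (run A I) ×
    ((τ : Sched I) → IsSchedule I τ → (M Mτ : ℕ) →
      MaxResponseTime (augment I) (run A I) M → MaxResponseTime I τ Mτ →
      M ≤ 2 * Mτ)
lemma5p3 = algorithm , λ I wf → Run.is-schedule I wf , Run.competitive I wf
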